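{- For every integer $n\ge 3$, let $C_n$ denote the cycle on $n$ vertices. Then $\chi'_L(C_n)=3$ if $n=3$, and $\chi'_L(C_n)=4$ if $n\ge 4$.
   Context: All graphs are finite, simple and connected with at least three vertices. For a proper edge coloring $c:E(G)\to\{1,\dots,k\}$ of a graph $G$, let $\pi=(\mathcal{C}_1,\dots,\mathcal{C}_k)$ be the ordered partition of $E(G)$ into color classes. For a vertex $v$ and an edge $e=xy$, $d(v,e)=\min\{d(v,x),d(v,y)\}$, and $d(v,\mathcal{C}_i)=\min\{d(v,e): e\in\mathcal{C}_i\}$. The edge color code of $v$ is $c_\pi(v)=(d(v,\mathcal{C}_1),\dots,d(v,\mathcal{C}_k))$. The coloring $c$ is an edge-locating coloring if distinct vertices have distinct edge color codes; $\chi'_L(G)$ is the minimum $k$ for which $G$ has an edge-locating coloring with $k$ colors. -}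

module Defs where

open import Data.Nat using (ℕ; zero; suc; _≤_; _⊓_; _≡ᵇ_)
open import Data.Fin using (Fin; toℕ)
open import Data.Bool using (Bool; T; _∨_; _∧_)
open import Data.Product using (Σ; _×_; ∃; ∃-syntax)
open import Relation.Binary.PropositionalEquality using (_≡_; _≢_)
open import Function.Bundles using (_⇔_)

Graph : ℕ → Set
Graph n = Fin n → Fin n → Bool

Adj : ∀ {n} → Graph n → Fin n → Fin n → Set
Adj G x y = T (G x y)

data Walk {n} (G : Graph n) : Fin n → Fin n → ℕ → Set where
  here : ∀ {u} → Walk G u u 0
  step : ∀ {u w v k} → Adj G u w → Walk G w v k → Walk G u v (suc k)

IsDist : ∀ {n} → Graph n → Fin n → Fin n → ℕ → Set
IsDist G u v d = Walk G u v d × (∀ k → Walk G u v k → d ≤ k)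

IsDistEdge : ∀ {n} → Graph n → Fin n → Fin n → Fin n → ℕ → Set
IsDistEdge G v x y d =
  ∃[ dx ] ∃[ dy ] (IsDist G v x dx × IsDist G v y dy × d ≡ dx ⊓ dy)

-- An edge colouring with k colours: a colour for every (oriented) edge,
-- independent of the orientation.
EdgeColouring : ∀ {n} → Graph n → ℕ → Set
EdgeColouring {n} G k = (x y : Fin n) → Adj G x y → Fin k

module _ {n : ℕ} (G : Graph n) {k : ℕ} (c : EdgeColouring G k) where

  WellDefined : Set
  WellDefined = ∀ x y (p : Adj G x y) (q : Adj G y x) → c x y p ≡ c y x q

  Proper : Set
  Proper = ∀ x y z (p : Adj G x y) (q : Adj G x z) → y ≢ z → c x y p ≢ c x z q

  -- every colour class C_i is non-empty (π is a partition into k classes)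
  AllClassesNonEmpty : Set
  AllClassesNonEmpty = ∀ (i : Fin k) → ∃[ x ] ∃[ y ] Σ (Adj G x y) (λ p → c x y p ≡ i)

  IsDistClass : Fin n → Fin k → ℕ → Set
  IsDistClass v i d =
    (∃[ x ] ∃[ y ] Σ (Adj G x y) (λ p → c x y p ≡ i × IsDistEdge G v x y d))
    × (∀ x y (p : Adj G x y) → c x y p ≡ i → ∀ d' → IsDistEdge G v x y d' → d ≤ d')

  SameCode : Fin n → Fin n → Set
  SameCode u v = ∀ (i : Fin k) (d : ℕ) → IsDistClass u i d ⇔ IsDistClass v i d

  IsEdgeLocating : Set
  IsEdgeLocating = WellDefined × Proper × AllClassesNonEmpty
                   × (∀ u v → SameCode u v → u ≡ v)

HasEdgeLocatingColouring : ∀ {n} → Graph n → ℕ → Set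
HasEdgeLocatingColouring G k = Σ (EdgeColouring G k) (λ c → IsEdgeLocating G c)

EdgeLocatingChromaticIndex : ∀ {n} → Graph n → ℕ → Set
EdgeLocatingChromaticIndex G k =
  HasEdgeLocatingColouring G k × (∀ j → HasEdgeLocatingColouring G j → k ≤ j)

-- The cycle C_n on vertices 0,…,n-1 with edges {i, i+1 mod n}.
nextᵇ : (n : ℕ) → Fin n → Fin n → Bool
nextᵇ n i j = (suc (toℕ i) ≡ᵇ toℕ j) ∨ ((suc (toℕ i) ≡ᵇ n) ∧ (toℕ j ≡ᵇ 0))

Cycle : (n : ℕ) → Graph n
Cycle n i j = nextᵇ n i j ∨ nextᵇ n j i

module Submission where

-- On a cycle every vertex meets exactly two colours, where its code is 0; at any other
-- colour i its code is 1 precisely when a neighbour meets i. With two colours all codes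
-- vanish. With three colours and n ≥ 4 every vertex misses exactly one colour. If each
-- vertex is adjacent to an edge of its missing colour, two vertices missing the same
-- colour (pigeonhole) have the same code. Otherwise pick v far from its missing colour i
-- and walk from v forwards and backwards up to the first edges of colour i. The two
-- vertices reached miss i and are adjacent to it, so they have equal codes; they are
-- distinct, since the successor of the forward end meets i, whereas the backward end is
-- v itself or has a successor missing i.
-- Conversely, give the edges {0,1} and {1,2} private colours and colour the remaining
-- edges properly with the other colours (one of them for C₃, two alternating ones for
-- n ≥ 4). The code of a vertex then contains its distances to these two edges, and these
-- determine the vertex.

open import Defs
open import Data.Nat using (ℕ; zero; suc; _+_; _∸_; _⊓_; _≤_; _<_; z≤n; s≤s; s≤s⁻¹; _≤?_; _<?_)
open import Data.Nat.Properties
open import Data.Fin as Fin using (Fin; toℕ; zero; suc)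
open import Data.Fin.Properties
  using (all?; any?; pigeonhole; toℕ-injective; toℕ<n; toℕ-fromℕ; toℕ-fromℕ<; toℕ-inject₁)
open import Data.Bool using (T)
open import Data.Bool.Properties using (T-∨; T-∧; ∨-comm; T-irrelevant)
open import Data.Empty using (⊥; ⊥-elim)
open import Data.Product using (Σ; ∃-syntax; _×_; _,_; proj₁; proj₂)
open import Data.Sum using (_⊎_; inj₁; inj₂; [_,_]′)
open import Function using (_∘_)
open import Function.Bundles using (_⇔_; mk⇔; Equivalence)
import Function.Properties.Equivalence as ⇔
open import Relation.Nullary using (¬_; Dec; yes; no; contradiction; ¬?)
open import Relation.Nullary.Decidable using (toWitness; _×-dec_; _→-dec_; _⊎-dec_)
open import Relation.Unary using (Decidable)
open import Relation.Binary.PropositionalEquality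
open import Relation.Binary.Definitions using (tri<; tri≈; tri>)

module _ {n : ℕ} {G : Graph n} where

  walk-length-zero : ∀ {u v} → Walk G u v 0 → u ≡ v
  walk-length-zero here = refl

  walk-snoc : ∀ {u v w d} → Walk G u v d → Adj G v w → Walk G u w (suc d)
  walk-snoc here a = step a here
  walk-snoc (step a r) b = step a (walk-snoc r b)

  walk-reverse : (∀ {x y} → Adj G x y → Adj G y x) →
                 ∀ {u v d} → Walk G u v d → Walk G v u d
  walk-reverse sym here = here
  walk-reverse sym (step a r) = walk-snoc (walk-reverse sym r) (sym a)

module GraphDistance {n : ℕ} {G : Graph n} (dist : Fin n → Fin n → ℕ)
                     (isDist : ∀ u v → IsDist G u v (dist u v)) where

  dist-unique : ∀ {u v d} → IsDist G u v d → d ≡ dist u v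
  dist-unique {u} {v} (w , least) =
    ≤-antisym (least _ (proj₁ (isDist u v))) (proj₂ (isDist u v) _ w)

  dist-self : ∀ u → dist u u ≡ 0
  dist-self u = n≤0⇒n≡0 (proj₂ (isDist u u) 0 here)

  dist≡0⇒≡ : ∀ {u v} → dist u v ≡ 0 → u ≡ v
  dist≡0⇒≡ {u} {v} d≡0 = walk-length-zero (subst (Walk G u v) d≡0 (proj₁ (isDist u v)))

  dist-adj : ∀ {u v} → Adj G u v → dist u v ≤ 1
  dist-adj a = proj₂ (isDist _ _) 1 (step a here)

  isDistEdge : ∀ v x y → IsDistEdge G v x y (dist v x ⊓ dist v y)
  isDistEdge v x y = _ , _ , isDist v x , isDist v y , refl

  isDistEdge-unique : ∀ {v x y d} → IsDistEdge G v x y d → d ≡ dist v x ⊓ dist v y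
  isDistEdge-unique (_ , _ , dx , dy , refl) = cong₂ _⊓_ (dist-unique dx) (dist-unique dy)

  edgeDist≡0⇒endpoint : ∀ {v x y} → dist v x ⊓ dist v y ≡ 0 → v ≡ x ⊎ v ≡ y
  edgeDist≡0⇒endpoint {v} {x} {y} e with ≤-total (dist v x) (dist v y)
  ... | inj₁ x≤y = inj₁ (dist≡0⇒≡ (trans (sym (m≤n⇒m⊓n≡m x≤y)) e))
  ... | inj₂ y≤x = inj₂ (dist≡0⇒≡ (trans (sym (m≥n⇒m⊓n≡n y≤x)) e))

  module EdgeCodes (adj-sym : ∀ {x y} → Adj G x y → Adj G y x)
                   {k : ℕ} (c : EdgeColouring G k) (wd : WellDefined G c) where

    Incident : Fin k → Fin n → Set
    Incident i v = ∃[ y ] Σ (Adj G v y) λ p → c v y p ≡ i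

    incident-target : ∀ {i x y} (p : Adj G x y) → c x y p ≡ i → Incident i y
    incident-target {x = x} {y} p e = x , adj-sym p , trans (sym (wd x y p (adj-sym p))) e

    Near : Fin k → Fin n → Set
    Near i v = ∃[ w ] Adj G v w × Incident i w

    distClass-incident : ∀ {i v} → Incident i v → ∀ d → IsDistClass G c v i d ⇔ d ≡ 0
    distClass-incident {i} {v} (y , p , e) d =
      mk⇔ (λ (_ , least) → n≤0⇒n≡0 (least v y p e 0 at-v))
          (λ { refl → (v , y , p , e , at-v) , λ _ _ _ _ _ _ → z≤n })
      where
      at-v : IsDistEdge G v v y 0
      at-v = subst (IsDistEdge G v v y) (cong (_⊓ dist v y) (dist-self v)) (isDistEdge v v y)

    ¬incident⇒edgeDist≥1 : ∀ {i v x y d} → ¬ Incident i v → (p : Adj G x y) → c x y p ≡ i →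
                           IsDistEdge G v x y d → 1 ≤ d
    ¬incident⇒edgeDist≥1 {i} {v} {x} {y} ¬inc p e ide =
      subst (1 ≤_) (sym (isDistEdge-unique ide))
            (n≢0⇒n>0 λ d≡0 → ¬inc (endpoint-incident (edgeDist≡0⇒endpoint d≡0)))
      where
      endpoint-incident : v ≡ x ⊎ v ≡ y → Incident i v
      endpoint-incident (inj₁ refl) = y , p , e
      endpoint-incident (inj₂ refl) = incident-target p e

    distClass-near : ∀ {i v w} → ¬ Incident i v → Adj G v w → Incident i w →
                     ∀ d → IsDistClass G c v i d ⇔ d ≡ 1
    distClass-near {i} {v} {w} ¬inc a (z , q , e) d = mk⇔ to from
      where
      w-at-1 : dist v w ⊓ dist v z ≡ 1
      w-at-1 = ≤-antisym (≤-trans (m⊓n≤m _ _) (dist-adj a))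
                         (¬incident⇒edgeDist≥1 ¬inc q e (isDistEdge v w z))
      to : IsDistClass G c v i d → d ≡ 1
      to ((_ , _ , p , e′ , ide) , least) =
        ≤-antisym (subst (d ≤_) w-at-1 (least w z q e _ (isDistEdge v w z)))
                  (¬incident⇒edgeDist≥1 ¬inc p e′ ide)
      from : d ≡ 1 → IsDistClass G c v i d
      from refl = (w , z , q , e , subst (IsDistEdge G v w z) w-at-1 (isDistEdge v w z)) ,
                  λ _ _ p e′ _ → ¬incident⇒edgeDist≥1 ¬inc p e′

    distClass-singleEdge : ∀ {i x y} →
      (∀ x′ y′ (p : Adj G x′ y′) → c x′ y′ p ≡ i →
        (x′ ≡ x × y′ ≡ y) ⊎ (x′ ≡ y × y′ ≡ x)) →
      (p : Adj G x y) → c x y p ≡ i → ∀ v d → IsDistClass G c v i d ⇔ d ≡ dist v x ⊓ dist v y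
    distClass-singleEdge {i} {x} {y} only p e v d = mk⇔ to from
      where
      value : ∀ {x′ y′ d′} (q : Adj G x′ y′) → c x′ y′ q ≡ i → IsDistEdge G v x′ y′ d′ →
              d′ ≡ dist v x ⊓ dist v y
      value q e′ ide with only _ _ q e′
      ... | inj₁ (refl , refl) = isDistEdge-unique ide
      ... | inj₂ (refl , refl) = trans (isDistEdge-unique ide) (⊓-comm _ _)
      to : IsDistClass G c v i d → d ≡ dist v x ⊓ dist v y
      to ((_ , _ , q , e′ , ide) , _) = value q e′ ide
      from : d ≡ dist v x ⊓ dist v y → IsDistClass G c v i d
      from refl = (x , y , p , e , isDistEdge v x y) ,
                  λ _ _ q e′ _ ide → ≤-reflexive (sym (value q e′ ide))

    sameCoordinate : ∀ {u w i r} →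
                     (∀ d → IsDistClass G c u i d ⇔ d ≡ r) → (∀ d → IsDistClass G c w i d ⇔ d ≡ r) →
                     ∀ d → IsDistClass G c u i d ⇔ IsDistClass G c w i d
    sameCoordinate cu cw d = ⇔.trans (cu d) (⇔.sym (cw d))

    sameCode⇒≡ : ∀ {u w i a b} → SameCode G c u w →
                 (∀ d → IsDistClass G c u i d ⇔ d ≡ a) → (∀ d → IsDistClass G c w i d ⇔ d ≡ b) → a ≡ b
    sameCode⇒≡ {i = i} {a} same cu cw =
      Equivalence.to (cw a) (Equivalence.to (same i a) (Equivalence.from (cu a) refl))

    sameCode-allIncident : ∀ {u w} → (∀ i → Incident i u) → (∀ i → Incident i w) → SameCode G c u w
    sameCode-allIncident incu incw i =
      sameCoordinate (distClass-incident (incu i)) (distClass-incident (incw i))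

    sameCode-nearMiss : ∀ {u w i} → (∀ j → j ≢ i → Incident j u) → (∀ j → j ≢ i → Incident j w) →
                        ¬ Incident i u → ¬ Incident i w → Near i u → Near i w → SameCode G c u w
    sameCode-nearMiss {i = i} incu incw ¬iu ¬iw (_ , ux , ix) (_ , wy , iy) j with j Fin.≟ i
    ... | yes refl = sameCoordinate (distClass-near ¬iu ux ix) (distClass-near ¬iw wy iy)
    ... | no j≢i = sameCoordinate (distClass-incident (incu j j≢i)) (distClass-incident (incw j j≢i))

distinct⇒2≤ : ∀ {j} {a b : Fin j} → a ≢ b → 2 ≤ j
distinct⇒2≤ {suc (suc _)} _ = s≤s (s≤s z≤n)
distinct⇒2≤ {suc zero} {zero} {zero} a≢b = contradiction refl a≢b

fin2-cover : (a b i : Fin 2) → a ≢ b → a ≡ i ⊎ b ≡ i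
fin2-cover = toWitness {a? = all? λ a → all? λ b → all? λ i →
  ¬? (a Fin.≟ b) →-dec ((a Fin.≟ i) ⊎-dec (b Fin.≟ i))} _

fin3-avoid : (a b : Fin 3) → ∃[ i ] a ≢ i × b ≢ i
fin3-avoid = toWitness {a? = all? λ a → all? λ b → any? λ i →
  ¬? (a Fin.≟ i) ×-dec ¬? (b Fin.≟ i)} _

fin3-cover : (a b i j : Fin 3) → a ≢ b → a ≢ i → b ≢ i → j ≢ i → a ≡ j ⊎ b ≡ j
fin3-cover = toWitness {a? = all? λ a → all? λ b → all? λ i → all? λ j →
  ¬? (a Fin.≟ b) →-dec (¬? (a Fin.≟ i) →-dec (¬? (b Fin.≟ i) →-dec
  (¬? (j Fin.≟ i) →-dec ((a Fin.≟ j) ⊎-dec (b Fin.≟ j)))))} _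

module _ {A : Set} {P : A → Set} (P? : Decidable P) (s : A → A) (μ : A → ℕ)
         (μ-step : ∀ u → ¬ P u → μ u ≡ suc (μ (s u))) where

  -- The last component says that f was reached from u without passing through P.
  orbit-exit : ∀ u → ¬ P u → ∃[ f ] ¬ P f × P (s f) × (f ≡ u ⊎ ∃[ y ] ¬ P y × f ≡ s y)
  orbit-exit u ¬Pu = go (μ u) u refl ¬Pu
    where
    go : ∀ d u → μ u ≡ d → ¬ P u → ∃[ f ] ¬ P f × P (s f) × (f ≡ u ⊎ ∃[ y ] ¬ P y × f ≡ s y)
    go zero u μu≡0 ¬Pu = contradiction (trans (sym (μ-step u ¬Pu)) μu≡0) 1+n≢0
    go (suc d) u μu≡1+d ¬Pu with P? (s u)
    ... | yes Psu = u , ¬Pu , Psu , inj₁ refl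
    ... | no ¬Psu with go d (s u) (suc-injective (trans (sym (μ-step u ¬Pu)) μu≡1+d)) ¬Psu
    ...   | f , ¬Pf , Psf , inj₁ refl = f , ¬Pf , Psf , inj₂ (u , ¬Pu , refl)
    ...   | f , ¬Pf , Psf , inj₂ earlier = f , ¬Pf , Psf , inj₂ earlier

⊓-⊓-dominated : ∀ {p q r u} → p ≤ r → q ≤ u → (p ⊓ u) ⊓ (r ⊓ q) ≡ p ⊓ q
⊓-⊓-dominated p≤r q≤u = ≤-antisym
  (⊓-glb (≤-trans (m⊓n≤m _ _) (m⊓n≤m _ _)) (≤-trans (m⊓n≤n _ _) (m⊓n≤n _ _)))
  (⊓-glb (⊓-mono-≤ ≤-refl q≤u) (⊓-mono-≤ p≤r ≤-refl))

⊓-shifted-cases : ∀ s t → (s ⊓ suc t ≡ suc t × suc s ⊓ t ≡ t) ⊎ (s ⊓ suc t ≡ s × s ≤ suc s ⊓ t)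
⊓-shifted-cases s t with suc t ≤? s
... | yes t<s = inj₁ (m≥n⇒m⊓n≡n t<s , m≥n⇒m⊓n≡n (≤-trans (n≤1+n t) (m≤n⇒m≤1+n t<s)))
... | no t≮s = inj₂ (m≤n⇒m⊓n≡m (<⇒≤ s<1+t) , ⊓-glb (n≤1+n s) (s≤s⁻¹ s<1+t))
  where
  s<1+t : s < suc t
  s<1+t = ≰⇒> t≮s

⊓-shifted-injective : ∀ {s t s′ t′} → s + t ≡ s′ + t′ →
                      s ⊓ suc t ≡ s′ ⊓ suc t′ → suc s ⊓ t ≡ suc s′ ⊓ t′ → t ≡ t′
⊓-shifted-injective {s} {t} {s′} {t′} sum e₀ e₁ with ⊓-shifted-cases s t | ⊓-shifted-cases s′ t′
... | inj₁ (_ , q) | inj₁ (_ , q′) = trans (sym q) (trans e₁ q′)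
... | inj₂ (p , _) | inj₂ (p′ , _) =
  +-cancelˡ-≡ s′ t t′ (trans (cong (_+ t) (sym (trans (sym p) (trans e₀ p′)))) sum)
... | inj₁ (p , q) | inj₂ (p′ , s′≤) = contradiction
  (≤-trans (≤-reflexive (trans (sym p) (trans e₀ p′))) (≤-trans s′≤ (≤-reflexive (trans (sym e₁) q))))
  1+n≰n
... | inj₂ (p , s≤) | inj₁ (p′ , q′) = contradiction
  (≤-trans (≤-reflexive (trans (sym p′) (trans (sym e₀) p))) (≤-trans s≤ (≤-reflexive (trans e₁ q′))))
  1+n≰n

module CycleGraph (m : ℕ) where

  N : ℕ
  N = 3 + m

  C : Graph N
  C = Cycle N

  next : Fin N → Fin N
  next v with suc (toℕ v) <? N
  ... | yes v+1<N = Fin.fromℕ< v+1<N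
  ... | no _ = zero

  prev : Fin N → Fin N
  prev zero = Fin.fromℕ (2 + m)
  prev (suc i) = Fin.inject₁ i

  data NextView (v : Fin N) : Fin N → Set where
    inner : suc (toℕ v) < N → ∀ {w} → toℕ w ≡ suc (toℕ v) → NextView v w
    wrap  : toℕ v ≡ 2 + m → NextView v zero

  next-view : ∀ v → NextView v (next v)
  next-view v with suc (toℕ v) <? N
  ... | yes v+1<N = inner v+1<N (toℕ-fromℕ< v+1<N)
  ... | no v+1≮N = wrap (≤-antisym (s≤s⁻¹ (toℕ<n v)) (s≤s⁻¹ (≮⇒≥ v+1≮N)))

  prev-next : ∀ v → prev (next v) ≡ v
  prev-next v with next v | next-view v
  ... | suc j | inner _ e = toℕ-injective (trans (toℕ-inject₁ j) (suc-injective e))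
  ... | zero  | wrap e = toℕ-injective (trans (toℕ-fromℕ (2 + m)) (sym e))

  next-prev : ∀ v → next (prev v) ≡ v
  next-prev zero with next (Fin.fromℕ (2 + m)) | next-view (Fin.fromℕ (2 + m))
  ... | _ | inner last+1<N _ =
    contradiction (subst (λ a → suc a < N) (toℕ-fromℕ (2 + m)) last+1<N) (<-irrefl refl)
  ... | _ | wrap _ = refl
  next-prev (suc i) with next (Fin.inject₁ i) | next-view (Fin.inject₁ i)
  ... | _ | inner _ e = toℕ-injective (trans e (cong suc (toℕ-inject₁ i)))
  ... | _ | wrap e = contradiction (trans (sym (toℕ-inject₁ i)) e) (<⇒≢ (s≤s⁻¹ (toℕ<n (suc i))))

  next≢self : ∀ v → next v ≢ v
  next≢self v with next v | next-view v
  ... | _ | inner _ e = λ { refl → 1+n≢n (sym e) }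
  ... | _ | wrap e = λ { refl → 0≢1+n e }

  prev≢self : ∀ v → prev v ≢ v
  prev≢self v e = next≢self (prev v) (trans (next-prev v) (sym e))

  next²≢self : ∀ v → next (next v) ≢ v
  next²≢self v with next v | next-view v
  ... | w | inner _ e with next w | next-view w
  ...   | _ | inner _ e′ = λ { refl → <-irrefl (trans e′ (cong suc e)) (m<n⇒m<1+n (n<1+n _)) }
  ...   | _ | wrap e′ = λ { refl → 0≢1+n (suc-injective (trans (sym e) e′)) }
  next²≢self v | _ | wrap e with next zero | next-view zero
  ...   | _ | inner _ e′ = λ { refl → 0≢1+n (suc-injective (trans (sym e′) e)) }
  ...   | _ | wrap ()

  next≢prev : ∀ v → next v ≢ prev v
  next≢prev v e = next²≢self v (trans (cong next e) (next-prev v))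

  nextᵇ-next : ∀ v → T (nextᵇ N v (next v))
  nextᵇ-next v with next v | next-view v
  ... | _ | inner _ e = Equivalence.from T-∨ (inj₁ (≡⇒≡ᵇ _ _ (sym e)))
  ... | _ | wrap e = Equivalence.from T-∨ (inj₂ (Equivalence.from T-∧ (≡⇒≡ᵇ _ _ (cong suc e) , _)))

  nextᵇ⇒next : ∀ v w → T (nextᵇ N v w) → w ≡ next v
  nextᵇ⇒next v w t with next v | next-view v | Equivalence.to T-∨ t
  ... | _ | inner _ e     | inj₁ t₁ = toℕ-injective (trans (sym (≡ᵇ⇒≡ _ _ t₁)) (sym e))
  ... | _ | inner v+1<N _ | inj₂ t₂ =
    contradiction (≡ᵇ⇒≡ _ _ (proj₁ (Equivalence.to T-∧ t₂))) (<⇒≢ v+1<N)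
  ... | _ | wrap e        | inj₁ t₁ =
    contradiction (trans (cong suc (sym e)) (≡ᵇ⇒≡ _ _ t₁)) (>⇒≢ (toℕ<n w))
  ... | _ | wrap _        | inj₂ t₂ = toℕ-injective (≡ᵇ⇒≡ _ _ (proj₂ (Equivalence.to T-∧ t₂)))

  adj-next : ∀ v → Adj C v (next v)
  adj-next v = Equivalence.from T-∨ (inj₁ (nextᵇ-next v))

  adj-sym : ∀ {x y} → Adj C x y → Adj C y x
  adj-sym {x} {y} = subst T (∨-comm (nextᵇ N x y) (nextᵇ N y x))

  adj-prev : ∀ v → Adj C v (prev v)
  adj-prev v = adj-sym {prev v} (subst (Adj C (prev v)) (next-prev v) (adj-next (prev v)))

  adj⇒next⊎prev : ∀ {x y} → Adj C x y → y ≡ next x ⊎ y ≡ prev x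
  adj⇒next⊎prev {x} {y} a with Equivalence.to T-∨ a
  ... | inj₁ t = inj₁ (nextᵇ⇒next x y t)
  ... | inj₂ t = inj₂ (trans (sym (prev-next y)) (cong prev (sym (nextᵇ⇒next y x t))))

  data Edge : Fin N → Fin N → Set where
    forwards  : ∀ x → Edge x (next x)
    backwards : ∀ x → Edge (next x) x

  edge-view : ∀ {x y} → Adj C x y → Edge x y
  edge-view {x} {y} a with adj⇒next⊎prev {x} {y} a
  ... | inj₁ refl = forwards x
  ... | inj₂ refl = subst (λ z → Edge z (prev x)) (next-prev x) (backwards (prev x))

  forward : ℕ → ℕ → ℕ
  forward a b with a ≤? b
  ... | yes _ = b ∸ a
  ... | no _ = N + b ∸ a

  forward-≤ : ∀ {a b} → a ≤ b → forward a b ≡ b ∸ a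
  forward-≤ {a} {b} a≤b with a ≤? b
  ... | yes _ = refl
  ... | no a≰b = contradiction a≤b a≰b

  forward-> : ∀ {a b} → b < a → forward a b ≡ N + b ∸ a
  forward-> {a} {b} b<a with a ≤? b
  ... | yes a≤b = contradiction a≤b (<⇒≱ b<a)
  ... | no _ = refl

  forward-self : ∀ a → forward a a ≡ 0
  forward-self a = trans (forward-≤ {a} ≤-refl) (n∸n≡0 a)

  forward≡0⇒≡ : ∀ {a b} → a < N → forward a b ≡ 0 → a ≡ b
  forward≡0⇒≡ {a} {b} a<N f≡0 with a ≤? b
  ... | yes a≤b = ≤-antisym a≤b (m∸n≡0⇒m≤n f≡0)
  ... | no _ = contradiction (≤-trans (m≤m+n N b) (m∸n≡0⇒m≤n f≡0)) (<⇒≱ a<N)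

  fw : Fin N → Fin N → ℕ
  fw u v = forward (toℕ u) (toℕ v)

  fw-self : ∀ u → fw u u ≡ 0
  fw-self u = forward-self (toℕ u)

  fw-next-source : ∀ {u v} → u ≢ v → fw u v ≡ suc (fw (next u) v)
  fw-next-source {u} {v} u≢v with next u | next-view u
  ... | _ | inner u+1<N e rewrite e with <-cmp (toℕ u) (toℕ v)
  ...   | tri< u<v _ _ =
    trans (forward-≤ (<⇒≤ u<v)) (trans (+-∸-assoc 1 u<v) (cong suc (sym (forward-≤ u<v))))
  ...   | tri≈ _ u≡v _ = contradiction (toℕ-injective u≡v) u≢v
  ...   | tri> _ _ v<u =
    trans (forward-> v<u) (trans (+-∸-assoc 1 (≤-trans (<⇒≤ u+1<N) (m≤m+n N _)))
                                 (cong suc (sym (forward-> (m<n⇒m<1+n v<u)))))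
  fw-next-source {u} {v} u≢v | _ | wrap e =
    trans (forward-> v<u) (trans (cong (λ a → N + toℕ v ∸ a) e)
          (trans (+-∸-assoc 1 (m≤m+n m (toℕ v)))
                 (cong suc (trans (m+n∸m≡n m (toℕ v)) (sym (forward-≤ z≤n))))))
    where
    v<u : toℕ v < toℕ u
    v<u = ≤∧≢⇒< (subst (toℕ v ≤_) (sym e) (s≤s⁻¹ (toℕ<n v)))
                (λ v≡u → u≢v (toℕ-injective (sym v≡u)))

  fw-next-target : ∀ {u v} → next u ≢ v → fw v (next u) ≡ suc (fw v u)
  fw-next-target {u} {v} u+1≢v with next u | next-view u
  ... | _ | inner _ e rewrite e with toℕ u <? toℕ v
  ...   | no u≮v =
    trans (forward-≤ (m≤n⇒m≤1+n v≤u)) (trans (+-∸-assoc 1 v≤u) (cong suc (sym (forward-≤ v≤u))))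
    where
    v≤u : toℕ v ≤ toℕ u
    v≤u = ≮⇒≥ u≮v
  ...   | yes u<v =
    trans (forward-> u+1<v) (trans (cong (_∸ toℕ v) (+-suc N (toℕ u)))
          (trans (+-∸-assoc 1 (≤-trans (<⇒≤ (toℕ<n v)) (m≤m+n N _))) (cong suc (sym (forward-> u<v)))))
    where
    u+1<v : suc (toℕ u) < toℕ v
    u+1<v = ≤∧≢⇒< u<v (λ u+1≡v → u+1≢v (toℕ-injective (trans e u+1≡v)))
  fw-next-target {u} {zero} zero≢zero | _ | wrap _ = contradiction refl zero≢zero
  fw-next-target {u} {suc j} _ | _ | wrap e =
    trans (forward-> {suc (toℕ j)} {0} (s≤s z≤n)) (trans (cong (_∸ suc (toℕ j)) (+-identityʳ N))
          (trans (+-∸-assoc 1 j<2+m)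
                 (cong suc (sym (trans (cong (forward (suc (toℕ j))) e) (forward-≤ j<2+m))))))
    where
    j<2+m : suc (toℕ j) ≤ 2 + m
    j<2+m = s≤s⁻¹ (toℕ<n (suc j))

  fw-prev-target : ∀ {u v} → u ≢ v → fw v u ≡ suc (fw v (prev u))
  fw-prev-target {u} {v} u≢v =
    subst (λ w → fw v w ≡ suc (fw v (prev u))) (next-prev u)
          (fw-next-target {prev u} {v} (λ e → u≢v (trans (sym (next-prev u)) e)))

  fw-next-source-≤ : ∀ u v → fw u v ≤ suc (fw (next u) v)
  fw-next-source-≤ u v with u Fin.≟ v
  ... | yes refl = ≤-trans (≤-reflexive (fw-self u)) z≤n
  ... | no u≢v = ≤-reflexive (fw-next-source u≢v)

  fw-next-target-≤ : ∀ u v → fw v (next u) ≤ suc (fw v u)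
  fw-next-target-≤ u v with next u Fin.≟ v
  ... | yes refl = ≤-trans (≤-reflexive (fw-self (next u))) z≤n
  ... | no u+1≢v = ≤-reflexive (fw-next-target u+1≢v)

  fw-walk : ∀ d u v → fw u v ≡ d → Walk C u v d
  fw-walk zero u v fw≡0 = subst (λ x → Walk C u x 0) (toℕ-injective (forward≡0⇒≡ (toℕ<n u) fw≡0)) here
  fw-walk (suc d) u v fw≡1+d =
    step (adj-next u) (fw-walk d (next u) v (suc-injective (trans (sym (fw-next-source u≢v)) fw≡1+d)))
    where
    u≢v : u ≢ v
    u≢v refl = 0≢1+n (trans (sym (fw-self u)) fw≡1+d)

  dist : Fin N → Fin N → ℕ
  dist u v = fw u v ⊓ fw v u

  dist-walk : ∀ u v → Walk C u v (dist u v)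
  dist-walk u v with ≤-total (fw u v) (fw v u)
  ... | inj₁ ≤ = subst (Walk C u v) (sym (m≤n⇒m⊓n≡m ≤)) (fw-walk _ u v refl)
  ... | inj₂ ≥ = subst (Walk C u v) (sym (m≥n⇒m⊓n≡n ≥))
                       (walk-reverse (λ {x} {y} → adj-sym {x} {y}) (fw-walk _ v u refl))

  dist-next-≤ : ∀ u v → dist u v ≤ suc (dist (next u) v)
  dist-next-≤ u v with next u Fin.≟ v
  ... | yes refl = ≤-trans (m⊓n≤m _ _) (≤-trans (fw-next-source-≤ u (next u))
                                                 (s≤s (≤-trans (≤-reflexive (fw-self (next u))) z≤n)))
  ... | no u+1≢v = ⊓-mono-≤ (fw-next-source-≤ u v)
                            (m≤n⇒m≤1+n (≤-trans (n≤1+n _) (≤-reflexive (sym (fw-next-target u+1≢v)))))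

  dist-next-≥ : ∀ u v → dist (next u) v ≤ suc (dist u v)
  dist-next-≥ u v with u Fin.≟ v
  ... | yes refl = ≤-trans (m⊓n≤n _ _) (≤-trans (fw-next-target-≤ u u)
                                                 (s≤s (≤-trans (≤-reflexive (fw-self u)) z≤n)))
  ... | no u≢v = ⊓-mono-≤ (m≤n⇒m≤1+n (≤-trans (n≤1+n _) (≤-reflexive (sym (fw-next-source u≢v)))))
                          (fw-next-target-≤ u v)

  dist-adj-≤ : ∀ {u w} → Adj C u w → ∀ v → dist u v ≤ suc (dist w v)
  dist-adj-≤ {u} {w} a v with adj⇒next⊎prev {u} {w} a
  ... | inj₁ refl = dist-next-≤ u v
  ... | inj₂ refl = subst (λ x → dist x v ≤ suc (dist (prev u) v)) (next-prev u) (dist-next-≥ (prev u) v)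

  walk⇒dist-≤ : ∀ {u v d} → Walk C u v d → dist u v ≤ d
  walk⇒dist-≤ {u} here = ≤-reflexive (cong₂ _⊓_ (fw-self u) (fw-self u))
  walk⇒dist-≤ {u} (step {w = w} a r) = ≤-trans (dist-adj-≤ {u} {w} a _) (s≤s (walk⇒dist-≤ r))

  isDist : ∀ u v → IsDist C u v (dist u v)
  isDist u v = dist-walk u v , λ _ → walk⇒dist-≤

  open GraphDistance dist isDist

  one two : Fin N
  one = suc zero
  two = suc (suc zero)

  dist-e₀ dist-e₁ : Fin N → ℕ
  dist-e₀ u = dist u zero ⊓ dist u one
  dist-e₁ u = dist u one ⊓ dist u two

  dist-below : ∀ {a b} → b ≤ a → a ≤ N → forward a b ⊓ forward b a ≡ (b + (N ∸ a)) ⊓ (a ∸ b)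
  dist-below {a} {b} b≤a a≤N with m≤n⇒m<n∨m≡n b≤a
  ... | inj₁ b<a =
    cong₂ _⊓_ (trans (forward-> b<a) (trans (+-∸-comm b a≤N) (+-comm (N ∸ a) b))) (forward-≤ b≤a)
  ... | inj₂ refl = trans (cong₂ _⊓_ (forward-self b) (forward-self b))
                          (sym (trans (cong ((b + (N ∸ b)) ⊓_) (n∸n≡0 b)) (⊓-zeroʳ _)))

  dist-e₀-beyond : ∀ i → dist-e₀ (suc (suc i)) ≡ (N ∸ (2 + toℕ i)) ⊓ suc (toℕ i)
  dist-e₀-beyond i = trans (cong₂ _⊓_ (dist-below z≤n a≤N) (dist-below (s≤s z≤n) a≤N))
                           (⊓-⊓-dominated (n≤1+n _) (n≤1+n _))
    where
    a≤N : 2 + toℕ i ≤ N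
    a≤N = <⇒≤ (toℕ<n (suc (suc i)))

  dist-e₁-beyond : ∀ i → dist-e₁ (suc (suc i)) ≡ suc (N ∸ (2 + toℕ i)) ⊓ toℕ i
  dist-e₁-beyond i = trans (cong₂ _⊓_ (dist-below (s≤s z≤n) a≤N) (dist-below (s≤s (s≤s z≤n)) a≤N))
                           (⊓-⊓-dominated (n≤1+n _) (n≤1+n _))
    where
    a≤N : 2 + toℕ i ≤ N
    a≤N = <⇒≤ (toℕ<n (suc (suc i)))

  beyond-sum : ∀ i → (N ∸ (2 + toℕ i)) + toℕ i ≡ suc m
  beyond-sum i = m∸n+n≡m (<⇒≤ (toℕ<n i))

  dist-e₀-beyond≢0 : ∀ i → dist-e₀ (suc (suc i)) ≢ 0
  dist-e₀-beyond≢0 i e = [ (λ ()) , (λ ()) ]′ (edgeDist≡0⇒endpoint {suc (suc i)} {zero} {one} e)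

  edgeDists-injective : ∀ u w → dist-e₀ u ≡ dist-e₀ w → dist-e₁ u ≡ dist-e₁ w → u ≡ w
  edgeDists-injective zero          zero          _  _  = refl
  edgeDists-injective zero          (suc zero)    _  ()
  edgeDists-injective (suc zero)    zero          _  ()
  edgeDists-injective (suc zero)    (suc zero)    _  _  = refl
  edgeDists-injective zero          (suc (suc j)) e₀ _  = contradiction (sym e₀) (dist-e₀-beyond≢0 j)
  edgeDists-injective (suc zero)    (suc (suc j)) e₀ _  = contradiction (sym e₀) (dist-e₀-beyond≢0 j)
  edgeDists-injective (suc (suc i)) zero          e₀ _  = contradiction e₀ (dist-e₀-beyond≢0 i)
  edgeDists-injective (suc (suc i)) (suc zero)    e₀ _  = contradiction e₀ (dist-e₀-beyond≢0 i)
  edgeDists-injective (suc (suc i)) (suc (suc j)) e₀ e₁ =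
    cong (λ k → suc (suc k)) (toℕ-injective (⊓-shifted-injective
      (trans (beyond-sum i) (sym (beyond-sum j)))
      (trans (sym (dist-e₀-beyond i)) (trans e₀ (dist-e₀-beyond j)))
      (trans (sym (dist-e₁-beyond i)) (trans e₁ (dist-e₁-beyond j)))))

  module CycleColouring {j : ℕ} (c : EdgeColouring C j) (wd : WellDefined C c) where
    open EdgeCodes (λ {x} {y} → adj-sym {x} {y}) c wd public

    colNext colPrev : Fin N → Fin j
    colNext v = c v (next v) (adj-next v)
    colPrev v = c v (prev v) (adj-prev v)

    colNext≢colPrev : Proper C c → ∀ v → colNext v ≢ colPrev v
    colNext≢colPrev pr v = pr v (next v) (prev v) (adj-next v) (adj-prev v) (next≢prev v)

    incident⇒colNext⊎colPrev : ∀ {i v} → Incident i v → colNext v ≡ i ⊎ colPrev v ≡ i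
    incident⇒colNext⊎colPrev {i} {v} (y , p , e) with adj⇒next⊎prev {v} {y} p
    ... | inj₁ refl = inj₁ (trans (cong (c v (next v)) (T-irrelevant _ _)) e)
    ... | inj₂ refl = inj₂ (trans (cong (c v (prev v)) (T-irrelevant _ _)) e)

    incident-next : ∀ {i v} → colNext v ≡ i → Incident i v
    incident-next {v = v} e = next v , adj-next v , e

    incident-prev : ∀ {i v} → colPrev v ≡ i → Incident i v
    incident-prev {v = v} e = prev v , adj-prev v , e

    incident? : ∀ i v → Dec (Incident i v)
    incident? i v with colNext v Fin.≟ i | colPrev v Fin.≟ i
    ... | yes e | _ = yes (incident-next e)
    ... | no _ | yes e = yes (incident-prev e)
    ... | no ¬n | no ¬p = no λ inc → [ ¬n , ¬p ]′ (incident⇒colNext⊎colPrev inc)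

    near? : ∀ i v → Dec (Near i v)
    near? i v with incident? i (next v) | incident? i (prev v)
    ... | yes inc | _ = yes (next v , adj-next v , inc)
    ... | no _ | yes inc = yes (prev v , adj-prev v , inc)
    ... | no ¬n | no ¬p = no λ (w , a , inc) →
      [ (λ { refl → ¬n inc }) , (λ { refl → ¬p inc }) ]′ (adj⇒next⊎prev {v} {w} a)

    exit-next : ∀ {i x} → Incident i x → ∀ u → ¬ Incident i u →
                ∃[ f ] ¬ Incident i f × Incident i (next f)
    exit-next {i} {x} ix u ¬iu =
      let f , ¬if , if+1 , _ = orbit-exit (incident? i) next (λ w → fw w x) closer u ¬iu in f , ¬if , if+1
      where
      closer : ∀ w → ¬ Incident i w → fw w x ≡ suc (fw (next w) x)
      closer w ¬iw = fw-next-source λ w≡x → ¬iw (subst (Incident i) (sym w≡x) ix)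

    exit-prev : ∀ {i x} → Incident i x → ∀ u → ¬ Incident i u →
                ∃[ b ] ¬ Incident i b × Incident i (prev b) × (b ≡ u ⊎ ¬ Incident i (next b))
    exit-prev {i} {x} ix u ¬iu with orbit-exit (incident? i) prev (λ w → fw x w) closer u ¬iu
      where
      closer : ∀ w → ¬ Incident i w → fw x w ≡ suc (fw x (prev w))
      closer w ¬iw = fw-prev-target λ w≡x → ¬iw (subst (Incident i) (sym w≡x) ix)
    ... | b , ¬ib , ib-1 , inj₁ b≡u = b , ¬ib , ib-1 , inj₁ b≡u
    ... | b , ¬ib , ib-1 , inj₂ (y , ¬iy , refl) =
      b , ¬ib , ib-1 , inj₂ (subst (λ w → ¬ Incident i w) (sym (next-prev y)) ¬iy)

  proper⇒2≤ : ∀ {j} (c : EdgeColouring C j) → Proper C c → 2 ≤ j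
  proper⇒2≤ c pr =
    distinct⇒2≤ (pr zero (next zero) (prev zero) (adj-next zero) (adj-prev zero) (next≢prev zero))

  ¬locating-2 : (c : EdgeColouring C 2) → ¬ IsEdgeLocating C c
  ¬locating-2 c (wd , pr , _ , locating) =
    next≢self zero (sym (locating zero (next zero) (sameCode-allIncident everywhere everywhere)))
    where
    open CycleColouring c wd
    everywhere : ∀ {v} i → Incident i v
    everywhere {v} i =
      [ incident-next , incident-prev ]′ (fin2-cover (colNext v) (colPrev v) i (colNext≢colPrev pr v))

  module LocatingThreeColouring (c : EdgeColouring C 3) (wd : WellDefined C c) (pr : Proper C c)
                                (nonEmpty : AllClassesNonEmpty C c)
                                (locating : ∀ u v → SameCode C c u v → u ≡ v) where
    open CycleColouring c wd

    missing : Fin N → Fin 3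
    missing v = proj₁ (fin3-avoid (colNext v) (colPrev v))

    missing-¬incident : ∀ v → ¬ Incident (missing v) v
    missing-¬incident v inc with fin3-avoid (colNext v) (colPrev v) | incident⇒colNext⊎colPrev inc
    ... | _ , n≢ , _ | inj₁ e = n≢ e
    ... | _ , _ , p≢ | inj₂ e = p≢ e

    incident-others : ∀ {i v} → ¬ Incident i v → ∀ i′ → i′ ≢ i → Incident i′ v
    incident-others {i} {v} ¬inc i′ i′≢i = [ incident-next , incident-prev ]′
      (fin3-cover (colNext v) (colPrev v) i i′ (colNext≢colPrev pr v)
                  (¬inc ∘ incident-next) (¬inc ∘ incident-prev) i′≢i)

    ¬incident-near⇒≡ : ∀ {i u w} → ¬ Incident i u → ¬ Incident i w → Near i u → Near i w → u ≡ w
    ¬incident-near⇒≡ ¬iu ¬iw nu nw =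
      locating _ _ (sameCode-nearMiss (incident-others ¬iu) (incident-others ¬iw) ¬iu ¬iw nu nw)

    ¬near⇒⊥ : ∀ v → ¬ Near (missing v) v → ⊥
    ¬near⇒⊥ v ¬near with nonEmpty (missing v)
    ... | x , y , p , e with exit-next (y , p , e) v (missing-¬incident v)
                           | exit-prev (y , p , e) v (missing-¬incident v)
    ...   | f , ¬if , if+1 | b , ¬ib , ib-1 , b-origin with f Fin.≟ b
    ...     | no f≢b = f≢b (¬incident-near⇒≡ ¬if ¬ib (next f , adj-next f , if+1) (prev b , adj-prev b , ib-1))
    ...     | yes refl = [ (λ { refl → ¬near (next f , adj-next f , if+1) }) , (λ ¬if+1 → ¬if+1 if+1) ]′ b-origin

    everywhere-near : ∀ v → Near (missing v) v
    everywhere-near v with near? (missing v) v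
    ... | yes near = near
    ... | no ¬near = ⊥-elim (¬near⇒⊥ v ¬near)

    missing-injective : ∀ u w → missing u ≡ missing w → u ≡ w
    missing-injective u w e =
      ¬incident-near⇒≡ (missing-¬incident u) (subst (λ i → ¬ Incident i w) (sym e) (missing-¬incident w))
                       (everywhere-near u) (subst (λ i → Near i w) (sym e) (everywhere-near w))

    no-collision : ¬ (∃[ x ] ∃[ y ] x Fin.< y × missing x ≡ missing y)
    no-collision (x , y , x<y , same) = <-irrefl (cong toℕ (missing-injective x y same)) x<y

  ¬locating-3 : 3 < N → (c : EdgeColouring C 3) → ¬ IsEdgeLocating C c
  ¬locating-3 3<N c (wd , pr , nonEmpty , locating) = no-collision (pigeonhole 3<N missing)
    where open LocatingThreeColouring c wd pr nonEmpty locating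

  locating⇒3≤ : ∀ {j} → HasEdgeLocatingColouring C j → 3 ≤ j
  locating⇒3≤ {0} (c , _ , pr , _) = contradiction (proper⇒2≤ c pr) λ ()
  locating⇒3≤ {1} (c , _ , pr , _) = contradiction (proper⇒2≤ c pr) λ { (s≤s ()) }
  locating⇒3≤ {2} (c , locating) = contradiction locating (¬locating-2 c)
  locating⇒3≤ {suc (suc (suc _))} _ = s≤s (s≤s (s≤s z≤n))

  locating⇒4≤ : 3 < N → ∀ {j} → HasEdgeLocatingColouring C j → 4 ≤ j
  locating⇒4≤ 3<N h = ≤∧≢⇒< (locating⇒3≤ h) λ { refl → ¬locating-3 3<N (proj₁ h) (proj₂ h) }

  -- col i is the colour of the edge {i, next i}.
  module EdgeSequenceColouring {j : ℕ} (col : Fin N → Fin j) (col-proper : ∀ v → col (prev v) ≢ col v) where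

    edgeIndex : Fin N → Fin N → Fin N
    edgeIndex x y with next x Fin.≟ y
    ... | yes _ = x
    ... | no _ = y

    edgeIndex-forwards : ∀ x → edgeIndex x (next x) ≡ x
    edgeIndex-forwards x with next x Fin.≟ next x
    ... | yes _ = refl
    ... | no x+1≢x+1 = contradiction refl x+1≢x+1

    edgeIndex-backwards : ∀ x → edgeIndex (next x) x ≡ x
    edgeIndex-backwards x with next (next x) Fin.≟ x
    ... | yes x+2≡x = contradiction x+2≡x (next²≢self x)
    ... | no _ = refl

    edgeIndex-prev : ∀ x → edgeIndex x (prev x) ≡ prev x
    edgeIndex-prev x =
      subst (λ w → edgeIndex w (prev x) ≡ prev x) (next-prev x) (edgeIndex-backwards (prev x))

    c : EdgeColouring C j
    c x y _ = col (edgeIndex x y)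

    wd : WellDefined C c
    wd x y p _ with edge-view {x} {y} p
    ... | forwards x′ = cong col (trans (edgeIndex-forwards x′) (sym (edgeIndex-backwards x′)))
    ... | backwards y′ = cong col (trans (edgeIndex-backwards y′) (sym (edgeIndex-forwards y′)))

    pr : Proper C c
    pr x y z p q y≢z with adj⇒next⊎prev {x} {y} p | adj⇒next⊎prev {x} {z} q
    ... | inj₁ refl | inj₁ refl = contradiction refl y≢z
    ... | inj₂ refl | inj₂ refl = contradiction refl y≢z
    ... | inj₁ refl | inj₂ refl = λ e → col-proper x
      (trans (cong col (sym (edgeIndex-prev x))) (trans (sym e) (cong col (edgeIndex-forwards x))))
    ... | inj₂ refl | inj₁ refl = λ e → col-proper x
      (trans (cong col (sym (edgeIndex-prev x))) (trans e (cong col (edgeIndex-forwards x))))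

    open EdgeCodes (λ {x} {y} → adj-sym {x} {y}) c wd

    uniqueColour⇒singleEdge : ∀ e → (∀ v → col v ≡ col e → v ≡ e) →
      ∀ x y (p : Adj C x y) → c x y p ≡ col e → (x ≡ e × y ≡ next e) ⊎ (x ≡ next e × y ≡ e)
    uniqueColour⇒singleEdge e unique x y p ce with edge-view {x} {y} p
    ... | forwards x′ = inj₁ (x′≡e , cong next x′≡e)
      where
      x′≡e : x′ ≡ e
      x′≡e = unique x′ (trans (cong col (sym (edgeIndex-forwards x′))) ce)
    ... | backwards y′ = inj₂ (cong next y′≡e , y′≡e)
      where
      y′≡e : y′ ≡ e
      y′≡e = unique y′ (trans (cong col (sym (edgeIndex-backwards y′))) ce)

    distClass-uniqueColour : ∀ e → (∀ v → col v ≡ col e → v ≡ e) →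
                             ∀ v d → IsDistClass C c v (col e) d ⇔ d ≡ dist v e ⊓ dist v (next e)
    distClass-uniqueColour e unique =
      distClass-singleEdge (uniqueColour⇒singleEdge e unique) (adj-next e) (cong col (edgeIndex-forwards e))

    edgeLocating : (∀ γ → ∃[ v ] col v ≡ γ) →
                   (∀ v → col v ≡ col zero → v ≡ zero) → (∀ v → col v ≡ col one → v ≡ one) →
                   HasEdgeLocatingColouring C j
    edgeLocating onto unique₀ unique₁ = c , wd , pr , nonEmpty , locating
      where
      nonEmpty : AllClassesNonEmpty C c
      nonEmpty γ with onto γ
      ... | v , e = v , next v , adj-next v , trans (cong col (edgeIndex-forwards v)) e
      locating : ∀ u w → SameCode C c u w → u ≡ w
      locating u w same = edgeDists-injective u w
        (sameCode⇒≡ same (distClass-uniqueColour zero unique₀ u) (distClass-uniqueColour zero unique₀ w))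
        (sameCode⇒≡ same (distClass-uniqueColour one unique₁ u) (distClass-uniqueColour one unique₁ w))

χ′L-C₃ : EdgeLocatingChromaticIndex (Cycle 3) 3
χ′L-C₃ = edgeLocating (λ γ → γ , refl) (λ _ e → e) (λ _ e → e) , λ _ → locating⇒3≤
  where
  open CycleGraph 0
  open EdgeSequenceColouring (λ v → v) prev≢self

parity : ℕ → Fin 4
parity 0 = zero
parity 1 = suc zero
parity (suc (suc e)) = parity e

alternating : ℕ → Fin 4
alternating 0 = suc (suc zero)
alternating 1 = suc (suc (suc zero))
alternating (suc (suc e)) = parity e

parity≢2 : ∀ e → parity e ≢ suc (suc zero)
parity≢2 0 ()
parity≢2 1 ()
parity≢2 (suc (suc e)) = parity≢2 e

parity≢3 : ∀ e → parity e ≢ suc (suc (suc zero))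
parity≢3 0 ()
parity≢3 1 ()
parity≢3 (suc (suc e)) = parity≢3 e

parity-step : ∀ e → parity e ≢ parity (suc e)
parity-step 0 ()
parity-step 1 ()
parity-step (suc (suc e)) = parity-step e

alternating-step : ∀ e → alternating e ≢ alternating (suc e)
alternating-step 0 ()
alternating-step 1 ()
alternating-step (suc (suc e)) = parity-step e

alternating≡2 : ∀ e → alternating e ≡ suc (suc zero) → e ≡ 0
alternating≡2 0 _ = refl
alternating≡2 1 ()
alternating≡2 (suc (suc e)) e≡2 = contradiction e≡2 (parity≢2 e)

alternating≡3 : ∀ e → alternating e ≡ suc (suc (suc zero)) → e ≡ 1
alternating≡3 0 ()
alternating≡3 1 _ = refl
alternating≡3 (suc (suc e)) e≡3 = contradiction e≡3 (parity≢3 e)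

χ′L-C₄₊ : ∀ m → EdgeLocatingChromaticIndex (Cycle (4 + m)) 4
χ′L-C₄₊ m = edgeLocating onto unique₀ unique₁ , λ _ → locating⇒4≤ (s≤s (s≤s (s≤s (s≤s z≤n))))
  where
  open CycleGraph (suc m)

  col : Fin N → Fin 4
  col v = alternating (toℕ v)

  col-proper : ∀ v → col (prev v) ≢ col v
  col-proper zero rewrite toℕ-fromℕ m = parity≢2 (suc m)
  col-proper (suc i) rewrite toℕ-inject₁ i = alternating-step (toℕ i)

  open EdgeSequenceColouring col col-proper

  onto : ∀ γ → ∃[ v ] col v ≡ γ
  onto zero = two , refl
  onto (suc zero) = suc (suc (suc zero)) , refl
  onto (suc (suc zero)) = zero , refl
  onto (suc (suc (suc zero))) = one , refl

  unique₀ : ∀ v → col v ≡ col zero → v ≡ zero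
  unique₀ v e = toℕ-injective (alternating≡2 (toℕ v) e)

  unique₁ : ∀ v → col v ≡ col one → v ≡ one
  unique₁ v e = toℕ-injective (alternating≡3 (toℕ v) e)

theorem2 : (n : ℕ) → 3 ≤ n →
    (n ≡ 3 → EdgeLocatingChromaticIndex (Cycle n) 3)
    × (4 ≤ n → EdgeLocatingChromaticIndex (Cycle n) 4)
theorem2 _ _ = (λ { refl → χ′L-C₃ }) , λ { (s≤s (s≤s (s≤s (s≤s {n = m} z≤n)))) → χ′L-C₄₊ m }
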